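{- Let $\mu\geq 1$ be an integer, and suppose that the integer $k\geq 1$ is not divisible by any odd prime $p<2^\mu$. Then $z^k+1$ divides $f_{2^\mu,n}(z)$ for infinitely many integers $n$, where $f_{m,n}(z)=\sum_{j=0}^{n}\binom{n}{j}z^{\binom{j}{m}}$.
   Context: Here $\binom{j}{m}=0$ for $0\le j<m$. -}

module Defs where

open import Data.Nat using (ℕ; zero; suc)
open import Data.Nat.Combinatorics using (_C_)
open import Data.Integer using (ℤ; +_; 0ℤ; 1ℤ) renaming (_+_ to _+ℤ_; _*_ to _*ℤ_)
open import Data.List using (List; []; _∷_; replicate; _++_; [_])
open import Data.Product using (∃)
open import Relation.Binary.PropositionalEquality using (_≡_)

-- Polynomials in ℤ[z], dense coefficient lists (lowest degree first).
Poly : Set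
Poly = List ℤ

coeff : Poly → ℕ → ℤ
coeff []       _       = 0ℤ
coeff (a ∷ p)  zero    = a
coeff (a ∷ p)  (suc i) = coeff p i

_⊕_ : Poly → Poly → Poly
[]      ⊕ q       = q
p       ⊕ []      = p
(a ∷ p) ⊕ (b ∷ q) = (a +ℤ b) ∷ (p ⊕ q)

scale : ℤ → Poly → Poly
scale c []      = []
scale c (a ∷ p) = (c *ℤ a) ∷ scale c p

_⊗_ : Poly → Poly → Poly
[]      ⊗ q = []
(a ∷ p) ⊗ q = scale a q ⊕ (0ℤ ∷ (p ⊗ q))

monomial : ℤ → ℕ → Poly
monomial c e = replicate e 0ℤ ++ [ c ]

-- divisibility in ℤ[z] (equality as polynomials = equal coefficients)
_∣ₚ_ : Poly → Poly → Set
d ∣ₚ f = ∃ λ (q : Poly) → ∀ i → coeff (d ⊗ q) i ≡ coeff f i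

zpow+1 : ℕ → Poly
zpow+1 k = monomial 1ℤ k ⊕ monomial 1ℤ 0

fsum : ℕ → ℕ → ℕ → Poly
fsum m n zero    = monomial (+ (n C 0)) (0 C m)
fsum m n (suc t) = fsum m n t ⊕ monomial (+ (n C suc t)) (suc t C m)

f : ℕ → ℕ → Poly
f m n = fsum m n n

-- Let m = 2^μ and s = m k u with u odd. For 0 < i < m, 2k divides C(s,i): indeed
-- i C(s,i) = s C(s-1,i-1), and i < m has fewer factors 2 than m and no odd prime factor in
-- common with k. Hence C(s-1,r) is odd for r < m (Pascal's rule), so C(s,m) = k u C(s-1,m-1) is
-- an odd multiple of k. Since x ↦ C(x,r) is a polynomial, these congruences give
-- C(a,m) ≡ C(j,m) + k (mod 2k) whenever a + j + 1 = s + m. Take n = s + m - 1, which is odd.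
-- Pairing j with n - j and using C(n,j) = C(n,n-j) writes f_{m,n} as a sum of terms
-- C(n,j)(z^C(j,m) + z^C(n-j,m)) whose exponents differ by an odd multiple of k, and z^k + 1
-- divides every z^a + z^(a+(2t+1)k). Letting u run through the odd numbers gives infinitely many n.

module Submission where

open import Defs
open import Data.Nat using (ℕ; _≤_; _<_; _^_)
open import Data.Nat.Divisibility using (_∣_)
open import Data.Nat.Primality using (Prime)
open import Data.Product using (∃; _×_)
open import Relation.Nullary using (¬_)

open import Data.Nat
  using (zero; suc; _+_; _*_; _∸_; pred; z<s; NonZero; NonTrivial; nonTrivial⇒n>1; ≢-nonZero; >-nonZero)
import Data.Nat.Properties as ℕ
import Data.Nat.Tactic.RingSolver as ℕ-Solver
open import Data.Nat.Combinatorics using (_C_; nCk≡nC[n∸k]; nCk+nC[k+1]≡[n+1]C[k+1]; k>n⇒nCk≡0; nC1≡n)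
open import Data.Nat.Divisibility
  using (divides; _∣?_; ∣-refl; ∣-reflexive; ∣-trans; _∣0; 0∣⇒≡0; ∣1⇒≡1; ∣⇒≤; m∣m*n;
         ∣m⇒∣m*n; ∣m∣n⇒∣m+n; ∣m+n∣m⇒∣n; *-monoˡ-∣; *-cancelˡ-∣)
open import Data.Nat.Coprimality using (Coprime; coprime-divisor)
open import Data.Nat.Primality using (euclidsLemma; prime[2]; ¬prime[1]; prime⇒nonTrivial)
open import Data.Nat.Primality.Factorisation using (factorise)
open import Data.Nat.ListAction using (product)
open import Data.Integer
  using (ℤ; +_; -[1+_]; 0ℤ; 1ℤ; -1ℤ; -_)
  renaming (_+_ to _+ℤ_; _*_ to _*ℤ_; _-_ to _-ℤ_; _^_ to _^ℤ_)
import Data.Integer.Properties as ℤ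
open import Data.Integer.Divisibility.Signed
  using (divides)
  renaming (_∣_ to _∣ℤ_; ∣m⇒∣-m to ∣ℤm⇒∣ℤ-m; ∣m∣n⇒∣m+n to ∣ℤm∣ℤn⇒∣ℤm+n)
import Data.Integer.Tactic.RingSolver as ℤ-Solver
open import Data.List using ([]; _∷_; replicate; _++_)
open import Data.List.Relation.Unary.All using (_∷_)
open import Data.Product using (_,_; proj₁; proj₂)
open import Data.Sum using (_⊎_; inj₁; inj₂; [_,_])
open import Level using (0ℓ)
open import Relation.Binary.Bundles using (Setoid)
open import Relation.Binary.PropositionalEquality
  using (_≡_; refl; sym; trans; cong; cong₂; subst; subst₂; module ≡-Reasoning)
open import Relation.Nullary using (yes; no; contradiction)

-- A record rather than a synonym for M ∣ x - y, so that x and y stay inferable.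
infix 4 _≡_[mod_]
record _≡_[mod_] (x y M : ℤ) : Set where
  constructor congruent
  field
    divides-difference : M ∣ℤ x -ℤ y

module _ {M : ℤ} where

  ≡-mod-reflexive : ∀ {x y} → x ≡ y → x ≡ y [mod M ]
  ≡-mod-reflexive {x} refl = congruent (divides 0ℤ (ℤ.+-inverseʳ x))

  ≡-mod-sym : ∀ {x y} → x ≡ y [mod M ] → y ≡ x [mod M ]
  ≡-mod-sym {x} {y} (congruent x≡y) = congruent (subst (M ∣ℤ_) (flip x y) (∣ℤm⇒∣ℤ-m x≡y))
    where
    flip : ∀ x y → - (x -ℤ y) ≡ y -ℤ x
    flip = ℤ-Solver.solve-∀

  ≡-mod-trans : ∀ {x y z} → x ≡ y [mod M ] → y ≡ z [mod M ] → x ≡ z [mod M ]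
  ≡-mod-trans {x} {y} {z} (congruent x≡y) (congruent y≡z) =
    congruent (subst (M ∣ℤ_) (chain x y z) (∣ℤm∣ℤn⇒∣ℤm+n x≡y y≡z))
    where
    chain : ∀ x y z → (x -ℤ y) +ℤ (y -ℤ z) ≡ x -ℤ z
    chain = ℤ-Solver.solve-∀

  +-cong-mod : ∀ {x y u v} → x ≡ y [mod M ] → u ≡ v [mod M ] → x +ℤ u ≡ y +ℤ v [mod M ]
  +-cong-mod {x} {y} {u} {v} (congruent x≡y) (congruent u≡v) =
    congruent (subst (M ∣ℤ_) (regroup x y u v) (∣ℤm∣ℤn⇒∣ℤm+n x≡y u≡v))
    where
    regroup : ∀ x y u v → (x -ℤ y) +ℤ (u -ℤ v) ≡ (x +ℤ u) -ℤ (y +ℤ v)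
    regroup = ℤ-Solver.solve-∀

  +-congˡ-mod : ∀ x {u v} → u ≡ v [mod M ] → x +ℤ u ≡ x +ℤ v [mod M ]
  +-congˡ-mod x = +-cong-mod (≡-mod-reflexive {x = x} refl)

  +-congʳ-mod : ∀ u {x y} → x ≡ y [mod M ] → x +ℤ u ≡ y +ℤ u [mod M ]
  +-congʳ-mod u x≡y = +-cong-mod x≡y (≡-mod-reflexive {x = u} refl)

  neg-cong-mod : ∀ {x y} → x ≡ y [mod M ] → - x ≡ - y [mod M ]
  neg-cong-mod {x} {y} (congruent x≡y) = congruent (subst (M ∣ℤ_) (negate x y) (∣ℤm⇒∣ℤ-m x≡y))
    where
    negate : ∀ x y → - (x -ℤ y) ≡ - x -ℤ - y
    negate = ℤ-Solver.solve-∀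

mod-setoid : ℤ → Setoid 0ℓ 0ℓ
mod-setoid M = record
  { Carrier       = ℤ
  ; _≈_           = _≡_[mod M ]
  ; isEquivalence = record
    { refl  = λ {x} → ≡-mod-reflexive {x = x} refl
    ; sym   = λ {x} {y} → ≡-mod-sym {x = x} {y}
    ; trans = λ {x} {y} {z} → ≡-mod-trans {x = x} {y} {z}
    }
  }

module ≡-mod-Reasoning (M : ℤ) where
  open import Relation.Binary.Reasoning.Setoid (mod-setoid M) public

+≡+[mod]⇒offset : ∀ {m n d} → + m ≡ + n [mod + d ] →
                  (∃ λ t → m ≡ n + t * d) ⊎ (∃ λ t → n ≡ m + t * d)
+≡+[mod]⇒offset {m} {n} {d} (congruent (divides (+ t) eq)) = inj₁ (t , ℤ.+-injective (begin
  + m                  ≡⟨ split (+ m) (+ n) ⟩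
  + n +ℤ (+ m -ℤ + n)  ≡⟨ cong (_+ℤ_ (+ n)) eq ⟩
  + n +ℤ + t *ℤ + d    ≡⟨ cong (_+ℤ_ (+ n)) (sym (ℤ.pos-* t d)) ⟩
  + (n + t * d)        ∎))
  where
  open ≡-Reasoning
  split : ∀ x y → x ≡ y +ℤ (x -ℤ y)
  split = ℤ-Solver.solve-∀
+≡+[mod]⇒offset {m} {n} {d} (congruent (divides -[1+ t ] eq)) = inj₂ (suc t , ℤ.+-injective (begin
  + n                         ≡⟨ split (+ n) (+ m) ⟩
  + m +ℤ - (+ m -ℤ + n)       ≡⟨ cong (λ x → + m +ℤ - x) eq ⟩
  + m +ℤ - (-[1+ t ] *ℤ + d)  ≡⟨ cong (_+ℤ_ (+ m)) (ℤ.neg-distribˡ-* -[1+ t ] (+ d)) ⟩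
  + m +ℤ + suc t *ℤ + d       ≡⟨ cong (_+ℤ_ (+ m)) (sym (ℤ.pos-* (suc t) d)) ⟩
  + (m + suc t * d)           ∎))
  where
  open ≡-Reasoning
  split : ∀ x y → x ≡ y +ℤ - (y -ℤ x)
  split = ℤ-Solver.solve-∀

offset⇒+≡+[mod] : ∀ {m n d} t → m ≡ n + t * d → + m ≡ + n [mod + d ]
offset⇒+≡+[mod] {m} {n} {d} t refl = congruent (divides (+ t) (begin
  + (n + t * d) -ℤ + n     ≡⟨ cong (_-ℤ + n) (ℤ.pos-+ n (t * d)) ⟩
  + n +ℤ + (t * d) -ℤ + n  ≡⟨ cancel (+ n) (+ (t * d)) ⟩
  + (t * d)                ≡⟨ ℤ.pos-* t d ⟩
  + t *ℤ + d               ∎))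
  where
  open ≡-Reasoning
  cancel : ∀ x y → x +ℤ y -ℤ x ≡ y
  cancel = ℤ-Solver.solve-∀

∑ : ℕ → (ℕ → ℤ) → ℤ
∑ zero    G = 0ℤ
∑ (suc t) G = ∑ t G +ℤ G t

syntax ∑ t (λ j → e) = ∑[ j < t ] e

∑-cong : ∀ t {G H : ℕ → ℤ} → (∀ j → j < t → G j ≡ H j) → ∑ t G ≡ ∑ t H
∑-cong zero    G≡H = refl
∑-cong (suc t) G≡H = cong₂ _+ℤ_ (∑-cong t (λ j j<t → G≡H j (ℕ.m<n⇒m<1+n j<t))) (G≡H t ℕ.≤-refl)

∑-+ : ∀ t (G H : ℕ → ℤ) → ∑[ j < t ] (G j +ℤ H j) ≡ ∑ t G +ℤ ∑ t H
∑-+ zero    G H = refl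
∑-+ (suc t) G H = trans (cong (_+ℤ (G t +ℤ H t)) (∑-+ t G H)) (interchange (∑ t G) (∑ t H) (G t) (H t))
  where
  interchange : ∀ a b c d → (a +ℤ b) +ℤ (c +ℤ d) ≡ (a +ℤ c) +ℤ (b +ℤ d)
  interchange = ℤ-Solver.solve-∀

∑-shift : ∀ t (G : ℕ → ℤ) → ∑ (suc t) G ≡ G 0 +ℤ ∑[ j < t ] G (suc j)
∑-shift zero    G = ℤ.+-comm 0ℤ (G 0)
∑-shift (suc t) G = trans (cong (_+ℤ G (suc t)) (∑-shift t G)) (ℤ.+-assoc (G 0) _ (G (suc t)))

∑-split : ∀ a b (G : ℕ → ℤ) → ∑ (a + b) G ≡ ∑ a G +ℤ ∑[ j < b ] G (a + j)
∑-split a zero    G = trans (cong (λ t → ∑ t G) (ℕ.+-identityʳ a)) (sym (ℤ.+-identityʳ _))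
∑-split a (suc b) G = begin
  ∑ (a + suc b) G                             ≡⟨ cong (λ t → ∑ t G) (ℕ.+-suc a b) ⟩
  ∑ (a + b) G +ℤ G (a + b)                    ≡⟨ cong (_+ℤ G (a + b)) (∑-split a b G) ⟩
  ∑ a G +ℤ ∑[ j < b ] G (a + j) +ℤ G (a + b)  ≡⟨ ℤ.+-assoc (∑ a G) _ _ ⟩
  ∑ a G +ℤ ∑[ j < suc b ] G (a + j)           ∎
  where open ≡-Reasoning

∑-reverse : ∀ t (G : ℕ → ℤ) → ∑ t G ≡ ∑[ j < t ] G (t ∸ suc j)
∑-reverse zero    G = refl
∑-reverse (suc t) G = begin
  ∑ t G +ℤ G t                     ≡⟨ ℤ.+-comm (∑ t G) (G t) ⟩
  G t +ℤ ∑ t G                     ≡⟨ cong (_+ℤ_ (G t)) (∑-reverse t G) ⟩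
  G t +ℤ ∑[ j < t ] G (t ∸ suc j)  ≡⟨ sym (∑-shift t (λ j → G (t ∸ j))) ⟩
  ∑[ j < suc t ] G (t ∸ j)         ∎
  where open ≡-Reasoning

∑-pairs : ∀ a (G : ℕ → ℤ) → ∑ (a + a) G ≡ ∑[ j < a ] (G j +ℤ G (a + a ∸ suc j))
∑-pairs a G = begin
  ∑ (a + a) G                              ≡⟨ ∑-split a a G ⟩
  ∑ a G +ℤ ∑[ j < a ] G (a + j)            ≡⟨ cong (_+ℤ_ (∑ a G)) (∑-reverse a (λ j → G (a + j))) ⟩
  ∑ a G +ℤ ∑[ j < a ] G (a + (a ∸ suc j))  ≡⟨ cong (_+ℤ_ (∑ a G)) (∑-cong a reindex) ⟩
  ∑ a G +ℤ ∑[ j < a ] G (a + a ∸ suc j)    ≡⟨ sym (∑-+ a G _) ⟩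
  ∑[ j < a ] (G j +ℤ G (a + a ∸ suc j))    ∎
  where
  open ≡-Reasoning
  reindex : ∀ j → j < a → G (a + (a ∸ suc j)) ≡ G (a + a ∸ suc j)
  reindex j j<a = cong G (sym (ℕ.+-∸-assoc a j<a))

δ : ℕ → ℕ → ℤ
δ zero    zero    = 1ℤ
δ zero    (suc i) = 0ℤ
δ (suc e) zero    = 0ℤ
δ (suc e) (suc i) = δ e i

coeff-⊕ : ∀ p q i → coeff (p ⊕ q) i ≡ coeff p i +ℤ coeff q i
coeff-⊕ []      q       i       = sym (ℤ.+-identityˡ _)
coeff-⊕ (a ∷ p) []      i       = sym (ℤ.+-identityʳ _)
coeff-⊕ (a ∷ p) (b ∷ q) zero    = refl
coeff-⊕ (a ∷ p) (b ∷ q) (suc i) = coeff-⊕ p q i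

coeff-scale : ∀ c p i → coeff (scale c p) i ≡ c *ℤ coeff p i
coeff-scale c []      i       = sym (ℤ.*-zeroʳ c)
coeff-scale c (a ∷ p) zero    = refl
coeff-scale c (a ∷ p) (suc i) = coeff-scale c p i

coeff-monomial : ∀ c e i → coeff (monomial c e) i ≡ c *ℤ δ e i
coeff-monomial c zero    zero    = sym (ℤ.*-identityʳ c)
coeff-monomial c zero    (suc i) = sym (ℤ.*-zeroʳ c)
coeff-monomial c (suc e) zero    = sym (ℤ.*-zeroʳ c)
coeff-monomial c (suc e) (suc i) = coeff-monomial c e i

coeff-∷-⊗ : ∀ a p q i → coeff ((a ∷ p) ⊗ q) i ≡ a *ℤ coeff q i +ℤ coeff (0ℤ ∷ p ⊗ q) i
coeff-∷-⊗ a p q i = trans (coeff-⊕ (scale a q) _ i) (cong (_+ℤ _) (coeff-scale a q i))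

coeff-⊗-[] : ∀ p i → coeff (p ⊗ []) i ≡ 0ℤ
coeff-⊗-[] []      i       = refl
coeff-⊗-[] (a ∷ p) zero    = refl
coeff-⊗-[] (a ∷ p) (suc i) = coeff-⊗-[] p i

coeff-⊗-⊕ : ∀ p q r i → coeff (p ⊗ (q ⊕ r)) i ≡ coeff (p ⊗ q) i +ℤ coeff (p ⊗ r) i
coeff-⊗-⊕ []      q r i = refl
coeff-⊗-⊕ (a ∷ p) q r i = begin
  coeff ((a ∷ p) ⊗ (q ⊕ r)) i
    ≡⟨ coeff-∷-⊗ a p (q ⊕ r) i ⟩
  a *ℤ coeff (q ⊕ r) i +ℤ coeff (0ℤ ∷ p ⊗ (q ⊕ r)) i
    ≡⟨ cong₂ _+ℤ_ (cong (a *ℤ_) (coeff-⊕ q r i)) (tail i) ⟩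
  a *ℤ (coeff q i +ℤ coeff r i) +ℤ (coeff (0ℤ ∷ p ⊗ q) i +ℤ coeff (0ℤ ∷ p ⊗ r) i)
    ≡⟨ distrib a (coeff q i) (coeff r i) _ _ ⟩
  (a *ℤ coeff q i +ℤ coeff (0ℤ ∷ p ⊗ q) i) +ℤ (a *ℤ coeff r i +ℤ coeff (0ℤ ∷ p ⊗ r) i)
    ≡⟨ sym (cong₂ _+ℤ_ (coeff-∷-⊗ a p q i) (coeff-∷-⊗ a p r i)) ⟩
  coeff ((a ∷ p) ⊗ q) i +ℤ coeff ((a ∷ p) ⊗ r) i ∎
  where
  open ≡-Reasoning
  tail : ∀ i → coeff (0ℤ ∷ p ⊗ (q ⊕ r)) i ≡ coeff (0ℤ ∷ p ⊗ q) i +ℤ coeff (0ℤ ∷ p ⊗ r) i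
  tail zero    = refl
  tail (suc i) = coeff-⊗-⊕ p q r i
  distrib : ∀ a x y u v → a *ℤ (x +ℤ y) +ℤ (u +ℤ v) ≡ (a *ℤ x +ℤ u) +ℤ (a *ℤ y +ℤ v)
  distrib = ℤ-Solver.solve-∀

coeff-⊗-scale : ∀ p c q i → coeff (p ⊗ scale c q) i ≡ c *ℤ coeff (p ⊗ q) i
coeff-⊗-scale []      c q i = sym (ℤ.*-zeroʳ c)
coeff-⊗-scale (a ∷ p) c q i = begin
  coeff ((a ∷ p) ⊗ scale c q) i
    ≡⟨ coeff-∷-⊗ a p (scale c q) i ⟩
  a *ℤ coeff (scale c q) i +ℤ coeff (0ℤ ∷ p ⊗ scale c q) i
    ≡⟨ cong₂ _+ℤ_ (cong (a *ℤ_) (coeff-scale c q i)) (tail i) ⟩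
  a *ℤ (c *ℤ coeff q i) +ℤ c *ℤ coeff (0ℤ ∷ p ⊗ q) i
    ≡⟨ distrib a c (coeff q i) _ ⟩
  c *ℤ (a *ℤ coeff q i +ℤ coeff (0ℤ ∷ p ⊗ q) i)
    ≡⟨ cong (c *ℤ_) (sym (coeff-∷-⊗ a p q i)) ⟩
  c *ℤ coeff ((a ∷ p) ⊗ q) i ∎
  where
  open ≡-Reasoning
  tail : ∀ i → coeff (0ℤ ∷ p ⊗ scale c q) i ≡ c *ℤ coeff (0ℤ ∷ p ⊗ q) i
  tail zero    = sym (ℤ.*-zeroʳ c)
  tail (suc i) = coeff-⊗-scale p c q i
  distrib : ∀ a c x u → a *ℤ (c *ℤ x) +ℤ c *ℤ u ≡ c *ℤ (a *ℤ x +ℤ u)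
  distrib = ℤ-Solver.solve-∀

coeff-⊕-⊗ : ∀ p q r i → coeff ((p ⊕ q) ⊗ r) i ≡ coeff (p ⊗ r) i +ℤ coeff (q ⊗ r) i
coeff-⊕-⊗ []      q       r i = sym (ℤ.+-identityˡ _)
coeff-⊕-⊗ (a ∷ p) []      r i = sym (ℤ.+-identityʳ _)
coeff-⊕-⊗ (a ∷ p) (b ∷ q) r i = begin
  coeff (((a +ℤ b) ∷ (p ⊕ q)) ⊗ r) i
    ≡⟨ coeff-∷-⊗ (a +ℤ b) (p ⊕ q) r i ⟩
  (a +ℤ b) *ℤ coeff r i +ℤ coeff (0ℤ ∷ (p ⊕ q) ⊗ r) i
    ≡⟨ cong (_+ℤ_ ((a +ℤ b) *ℤ coeff r i)) (tail i) ⟩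
  (a +ℤ b) *ℤ coeff r i +ℤ (coeff (0ℤ ∷ p ⊗ r) i +ℤ coeff (0ℤ ∷ q ⊗ r) i)
    ≡⟨ distrib a b (coeff r i) _ _ ⟩
  (a *ℤ coeff r i +ℤ coeff (0ℤ ∷ p ⊗ r) i) +ℤ (b *ℤ coeff r i +ℤ coeff (0ℤ ∷ q ⊗ r) i)
    ≡⟨ sym (cong₂ _+ℤ_ (coeff-∷-⊗ a p r i) (coeff-∷-⊗ b q r i)) ⟩
  coeff ((a ∷ p) ⊗ r) i +ℤ coeff ((b ∷ q) ⊗ r) i ∎
  where
  open ≡-Reasoning
  tail : ∀ i → coeff (0ℤ ∷ (p ⊕ q) ⊗ r) i ≡ coeff (0ℤ ∷ p ⊗ r) i +ℤ coeff (0ℤ ∷ q ⊗ r) i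
  tail zero    = refl
  tail (suc i) = coeff-⊕-⊗ p q r i
  distrib : ∀ a b x u v → (a +ℤ b) *ℤ x +ℤ (u +ℤ v) ≡ (a *ℤ x +ℤ u) +ℤ (b *ℤ x +ℤ v)
  distrib = ℤ-Solver.solve-∀

coeff-monomial-⊗ : ∀ c e q i → coeff (monomial c e ⊗ q) i ≡ c *ℤ coeff (replicate e 0ℤ ++ q) i
coeff-monomial-⊗ c zero    q i       =
  trans (coeff-∷-⊗ c [] q i) (trans (cong (_+ℤ_ (c *ℤ coeff q i)) (vanish i)) (ℤ.+-identityʳ _))
  where
  vanish : ∀ i → coeff (0ℤ ∷ []) i ≡ 0ℤ
  vanish zero    = refl
  vanish (suc i) = refl
coeff-monomial-⊗ c (suc e) q zero    =
  trans (coeff-∷-⊗ 0ℤ (monomial c e) q 0) (sym (ℤ.*-zeroʳ c))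
coeff-monomial-⊗ c (suc e) q (suc i) =
  trans (coeff-∷-⊗ 0ℤ (monomial c e) q (suc i))
        (trans (ℤ.+-identityˡ _) (coeff-monomial-⊗ c e q i))

replicate-++-monomial : ∀ c d e → replicate d 0ℤ ++ monomial c e ≡ monomial c (d + e)
replicate-++-monomial c zero    e = refl
replicate-++-monomial c (suc d) e = cong (0ℤ ∷_) (replicate-++-monomial c d e)

-- Divisibility by z^K + 1

-- A record, like _≡_[mod_], so that d stays inferable.
infix 4 _∣ᶜ_
record _∣ᶜ_ (d : Poly) (g : ℕ → ℤ) : Set where
  constructor divides
  field
    quotient : Poly
    equality : ∀ i → coeff (d ⊗ quotient) i ≡ g i

∣ᶜ⇒∣ₚ : ∀ {d p} → d ∣ᶜ coeff p → d ∣ₚ p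
∣ᶜ⇒∣ₚ (divides q eq) = q , eq

module _ {d : Poly} where

  ∣ᶜ-resp : ∀ {g h} → (∀ i → g i ≡ h i) → d ∣ᶜ g → d ∣ᶜ h
  ∣ᶜ-resp g≡h (divides q dq≡g) = divides q λ i → trans (dq≡g i) (g≡h i)

  ∣ᶜ-0 : d ∣ᶜ (λ _ → 0ℤ)
  ∣ᶜ-0 = divides [] (coeff-⊗-[] d)

  ∣ᶜ-+ : ∀ {g h} → d ∣ᶜ g → d ∣ᶜ h → d ∣ᶜ (λ i → g i +ℤ h i)
  ∣ᶜ-+ (divides q dq≡g) (divides r dr≡h) =
    divides (q ⊕ r) λ i → trans (coeff-⊗-⊕ d q r i) (cong₂ _+ℤ_ (dq≡g i) (dr≡h i))

  ∣ᶜ-* : ∀ c {g} → d ∣ᶜ g → d ∣ᶜ (λ i → c *ℤ g i)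
  ∣ᶜ-* c (divides q dq≡g) =
    divides (scale c q) λ i → trans (coeff-⊗-scale d c q i) (cong (c *ℤ_) (dq≡g i))

  ∣ᶜ-∑ : ∀ t {G : ℕ → ℕ → ℤ} → (∀ j → j < t → d ∣ᶜ G j) → d ∣ᶜ (λ i → ∑[ j < t ] G j i)
  ∣ᶜ-∑ zero    d∣G = ∣ᶜ-0
  ∣ᶜ-∑ (suc t) d∣G = ∣ᶜ-+ (∣ᶜ-∑ t (λ j j<t → d∣G j (ℕ.m<n⇒m<1+n j<t))) (d∣G t ℕ.≤-refl)

z^_+z^_ : ℕ → ℕ → ℕ → ℤ
(z^ a +z^ b) i = δ a i +ℤ δ b i

coeff-zpow+1-⊗-monomial : ∀ K e i → coeff (zpow+1 K ⊗ monomial 1ℤ e) i ≡ (z^ (K + e) +z^ e) i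
coeff-zpow+1-⊗-monomial K e i = begin
  coeff ((monomial 1ℤ K ⊕ monomial 1ℤ 0) ⊗ z^e) i
    ≡⟨ coeff-⊕-⊗ (monomial 1ℤ K) (monomial 1ℤ 0) z^e i ⟩
  coeff (monomial 1ℤ K ⊗ z^e) i +ℤ coeff (monomial 1ℤ 0 ⊗ z^e) i
    ≡⟨ cong₂ _+ℤ_ (coeff-monomial-⊗ 1ℤ K z^e i) (coeff-monomial-⊗ 1ℤ 0 z^e i) ⟩
  1ℤ *ℤ coeff (replicate K 0ℤ ++ z^e) i +ℤ 1ℤ *ℤ coeff z^e i
    ≡⟨ cong₂ _+ℤ_ (cong (λ p → 1ℤ *ℤ coeff p i) (replicate-++-monomial 1ℤ K e)) refl ⟩
  1ℤ *ℤ coeff (monomial 1ℤ (K + e)) i +ℤ 1ℤ *ℤ coeff z^e i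
    ≡⟨ cong₂ _+ℤ_ (coeff-z^ (K + e)) (coeff-z^ e) ⟩
  δ (K + e) i +ℤ δ e i ∎
  where
  open ≡-Reasoning
  z^e = monomial 1ℤ e
  coeff-z^ : ∀ e → 1ℤ *ℤ coeff (monomial 1ℤ e) i ≡ δ e i
  coeff-z^ e = trans (ℤ.*-identityˡ _) (trans (coeff-monomial 1ℤ e i) (ℤ.*-identityˡ _))

z^K+1∣z^[K+e]+z^e : ∀ K e → zpow+1 K ∣ᶜ z^ (K + e) +z^ e
z^K+1∣z^[K+e]+z^e K e = divides (monomial 1ℤ e) (coeff-zpow+1-⊗-monomial K e)

z^K+1∣z^a+z^[a+K+t*2K] : ∀ K a t → zpow+1 K ∣ᶜ z^ a +z^ (a + K + t * (2 * K))
z^K+1∣z^a+z^[a+K+t*2K] K a zero    =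
  ∣ᶜ-resp (λ i → trans (ℤ.+-comm (δ (K + a) i) (δ a i)) (cong (λ e → δ a i +ℤ δ e i) (exponent K a)))
          (z^K+1∣z^[K+e]+z^e K a)
  where
  exponent : ∀ K a → K + a ≡ a + K + 0
  exponent = ℕ-Solver.solve-∀
z^K+1∣z^a+z^[a+K+t*2K] K a (suc t) =
  ∣ᶜ-resp telescope
    (∣ᶜ-+ (∣ᶜ-+ (z^K+1∣z^a+z^[a+K+t*2K] K a t) (∣ᶜ-* -1ℤ (z^K+1∣z^[K+e]+z^e K b)))
          (z^K+1∣z^[K+e]+z^e K (K + b)))
  where
  b = a + K + t * (2 * K)
  exponent : ∀ a K t → K + (K + (a + K + t * (2 * K))) ≡ a + K + suc t * (2 * K)
  exponent = ℕ-Solver.solve-∀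
  cancel : ∀ x y v w → (x +ℤ y) +ℤ -1ℤ *ℤ (v +ℤ y) +ℤ (w +ℤ v) ≡ x +ℤ w
  cancel = ℤ-Solver.solve-∀
  -- z^a + z^(b+2K) = (z^a + z^b) - z^b (z^K + 1) + z^(K+b) (z^K + 1)
  telescope : ∀ i → (z^ a +z^ b) i +ℤ -1ℤ *ℤ (z^ (K + b) +z^ b) i +ℤ (z^ (K + (K + b)) +z^ (K + b)) i
                  ≡ (z^ a +z^ (a + K + suc t * (2 * K))) i
  telescope i = trans (cancel (δ a i) (δ b i) (δ (K + b) i) (δ (K + (K + b)) i))
                      (cong (λ e → δ a i +ℤ δ e i) (exponent a K t))

z^K+1∣z^a+z^b : ∀ {K a b} → + b ≡ + a +ℤ + K [mod + (2 * K) ] → zpow+1 K ∣ᶜ z^ a +z^ b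
z^K+1∣z^a+z^b {K} {a} {b} b≡a+K with +≡+[mod]⇒offset {b} {a + K} b≡a+K
... | inj₁ (t , refl)  = z^K+1∣z^a+z^[a+K+t*2K] K a t
... | inj₂ (zero , a+K≡b+0) =
  subst (λ e → zpow+1 K ∣ᶜ z^ a +z^ e) (trans (ℕ.+-identityʳ _) (trans a+K≡b+0 (ℕ.+-identityʳ b)))
    (z^K+1∣z^a+z^[a+K+t*2K] K a 0)
... | inj₂ (suc t , a+K≡b+[1+t]*2K) =
  ∣ᶜ-resp (λ i → ℤ.+-comm (δ b i) (δ a i))
    (subst (λ e → zpow+1 K ∣ᶜ z^ b +z^ e) (sym a≡b+K+t*2K) (z^K+1∣z^a+z^[a+K+t*2K] K b t))
  where
  a≡b+K+t*2K : a ≡ b + K + t * (2 * K)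
  a≡b+K+t*2K = ℕ.+-cancelʳ-≡ K a _ (trans a+K≡b+[1+t]*2K (regroup b K t))
    where
    regroup : ∀ b K t → b + suc t * (2 * K) ≡ b + K + t * (2 * K) + K
    regroup = ℕ-Solver.solve-∀

coeff-fsum : ∀ m n t i → coeff (fsum m n t) i ≡ ∑[ j < suc t ] (+ (n C j) *ℤ δ (j C m) i)
coeff-fsum m n zero    i = trans (coeff-monomial _ (0 C m) i) (sym (ℤ.+-identityˡ _))
coeff-fsum m n (suc t) i =
  trans (coeff-⊕ (fsum m n t) _ i) (cong₂ _+ℤ_ (coeff-fsum m n t i) (coeff-monomial _ (suc t C m) i))

<half⇒≤ : ∀ {n a j} → suc n ≡ a + a → j < a → j ≤ n
<half⇒≤ {a = a} 1+n≡a+a j<a = ℕ.≤-pred (ℕ.<-≤-trans j<a (subst (a ≤_) (sym 1+n≡a+a) (ℕ.m≤m+n a a)))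

z^K+1∣f : ∀ K m n a → suc n ≡ a + a →
          (∀ j → j < a → + ((n ∸ j) C m) ≡ + (j C m) +ℤ + K [mod + (2 * K) ]) →
          zpow+1 K ∣ₚ f m n
z^K+1∣f K m n a 1+n≡a+a pairs = ∣ᶜ⇒∣ₚ {zpow+1 K} {f m n} (∣ᶜ-resp (λ i → sym (paired i))
  (∣ᶜ-∑ a λ j j<a → ∣ᶜ-* (+ (n C j)) (z^K+1∣z^a+z^b {K} {j C m} {(n ∸ j) C m} (pairs j j<a))))
  where
  term : ℕ → ℕ → ℤ
  term i j = + (n C j) *ℤ δ (j C m) i
  symmetric : ∀ i j → j < a →
              term i j +ℤ term i (a + a ∸ suc j) ≡ + (n C j) *ℤ (z^ (j C m) +z^ ((n ∸ j) C m)) i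
  symmetric i j j<a = begin
    term i j +ℤ term i (a + a ∸ suc j)
      ≡⟨ cong (λ t → term i j +ℤ term i (t ∸ suc j)) (sym 1+n≡a+a) ⟩
    + (n C j) *ℤ δ (j C m) i +ℤ + (n C (n ∸ j)) *ℤ δ ((n ∸ j) C m) i
      ≡⟨ cong (λ c → + (n C j) *ℤ δ (j C m) i +ℤ + c *ℤ δ ((n ∸ j) C m) i)
              (sym (nCk≡nC[n∸k] (<half⇒≤ 1+n≡a+a j<a))) ⟩
    + (n C j) *ℤ δ (j C m) i +ℤ + (n C j) *ℤ δ ((n ∸ j) C m) i
      ≡⟨ sym (ℤ.*-distribˡ-+ (+ (n C j)) _ _) ⟩
    + (n C j) *ℤ (δ (j C m) i +ℤ δ ((n ∸ j) C m) i) ∎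
    where open ≡-Reasoning
  paired : ∀ i → coeff (f m n) i ≡ ∑[ j < a ] (+ (n C j) *ℤ (z^ (j C m) +z^ ((n ∸ j) C m)) i)
  paired i = begin
    coeff (fsum m n n) i                                        ≡⟨ coeff-fsum m n n i ⟩
    ∑ (suc n) (term i)                                          ≡⟨ cong (λ t → ∑ t (term i)) 1+n≡a+a ⟩
    ∑ (a + a) (term i)                                          ≡⟨ ∑-pairs a (term i) ⟩
    ∑[ j < a ] (term i j +ℤ term i (a + a ∸ suc j))             ≡⟨ ∑-cong a (symmetric i) ⟩
    ∑[ j < a ] (+ (n C j) *ℤ (z^ (j C m) +z^ ((n ∸ j) C m)) i)  ∎
    where open ≡-Reasoning

-- Binomial coefficients modulo M

infix 8 _Cℤ_
_Cℤ_ : ℕ → ℕ → ℤ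
n Cℤ k = + (n C k)

pascal : ∀ n k → suc n Cℤ suc k ≡ n Cℤ k +ℤ n Cℤ suc k
pascal n k = trans (cong +_ (sym (nCk+nC[k+1]≡[n+1]C[k+1] n k))) (ℤ.pos-+ (n C k) (n C suc k))

-- If C(s,i) ≡ 0 for 0 < i < m, then x ↦ C(x,r) is s-periodic modulo M for r < m (Vandermonde),
-- and C(r-1-j,r) = (-1)^r C(j,r) as polynomials in j; together C(a,r) ≡ (-1)^r C(j,r) whenever
-- a + j + 1 = s + r. As r-1-j is not a natural number, this is proved instead by induction on r,
-- each step by induction on j with Pascal's rule.
module BinomialCongruences {M : ℤ} {s m : ℕ}
  (vanish : ∀ i → 0 < i → i < m → s Cℤ i ≡ 0ℤ [mod M ]) where

  open ≡-mod-Reasoning M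

  [s+r]Ct≡rCt+sCt : ∀ r t → 0 < t → t ≤ m → (s + r) Cℤ t ≡ r Cℤ t +ℤ s Cℤ t [mod M ]
  [s+r]Ct≡rCt+sCt zero    (suc t)       _ _     = begin
    (s + 0) Cℤ suc t          ≡⟨ cong (_Cℤ suc t) (ℕ.+-identityʳ s) ⟩
    s Cℤ suc t                ≡⟨ sym (ℤ.+-identityˡ _) ⟩
    0 Cℤ suc t +ℤ s Cℤ suc t  ∎
  [s+r]Ct≡rCt+sCt (suc r) (suc zero)    _ 1≤m   = begin
    (s + suc r) Cℤ 1              ≡⟨ trans (cong (_Cℤ 1) (ℕ.+-suc s r)) (pascal (s + r) 0) ⟩
    (s + r) Cℤ 0 +ℤ (s + r) Cℤ 1  ≈⟨ +-congˡ-mod (r Cℤ 0) ([s+r]Ct≡rCt+sCt r 1 z<s 1≤m) ⟩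
    r Cℤ 0 +ℤ (r Cℤ 1 +ℤ s Cℤ 1)  ≡⟨ sym (ℤ.+-assoc (r Cℤ 0) (r Cℤ 1) (s Cℤ 1)) ⟩
    r Cℤ 0 +ℤ r Cℤ 1 +ℤ s Cℤ 1    ≡⟨ cong (_+ℤ s Cℤ 1) (sym (pascal r 0)) ⟩
    suc r Cℤ 1 +ℤ s Cℤ 1          ∎
  [s+r]Ct≡rCt+sCt (suc r) (suc (suc t)) _ t+2≤m = begin
    (s + suc r) Cℤ (2 + t)
      ≡⟨ trans (cong (_Cℤ (2 + t)) (ℕ.+-suc s r)) (pascal (s + r) (suc t)) ⟩
    (s + r) Cℤ suc t +ℤ (s + r) Cℤ (2 + t)
      ≈⟨ +-cong-mod ([s+r]Ct≡rCt+sCt r (suc t) z<s (ℕ.<⇒≤ t+2≤m))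
                    ([s+r]Ct≡rCt+sCt r (2 + t) z<s t+2≤m) ⟩
    (r Cℤ suc t +ℤ s Cℤ suc t) +ℤ (r Cℤ (2 + t) +ℤ s Cℤ (2 + t))
      ≈⟨ +-congʳ-mod (r Cℤ (2 + t) +ℤ s Cℤ (2 + t))
                     (+-congˡ-mod (r Cℤ suc t) (vanish (suc t) z<s t+2≤m)) ⟩
    (r Cℤ suc t +ℤ 0ℤ) +ℤ (r Cℤ (2 + t) +ℤ s Cℤ (2 + t))
      ≡⟨ regroup (r Cℤ suc t) (r Cℤ (2 + t)) (s Cℤ (2 + t)) ⟩
    (r Cℤ suc t +ℤ r Cℤ (2 + t)) +ℤ s Cℤ (2 + t)
      ≡⟨ cong (_+ℤ s Cℤ (2 + t)) (sym (pascal r (suc t))) ⟩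
    suc r Cℤ (2 + t) +ℤ s Cℤ (2 + t) ∎
    where
    regroup : ∀ x y z → (x +ℤ 0ℤ) +ℤ (y +ℤ z) ≡ (x +ℤ y) +ℤ z
    regroup = ℤ-Solver.solve-∀

  [s+r]C[1+r]≡sC[1+r] : ∀ r → suc r ≤ m → (s + r) Cℤ suc r ≡ s Cℤ suc r [mod M ]
  [s+r]C[1+r]≡sC[1+r] r r<m = begin
    (s + r) Cℤ suc r          ≈⟨ [s+r]Ct≡rCt+sCt r (suc r) z<s r<m ⟩
    r Cℤ suc r +ℤ s Cℤ suc r  ≡⟨ cong (λ c → + c +ℤ s Cℤ suc r) (k>n⇒nCk≡0 (ℕ.n<1+n r)) ⟩
    0ℤ +ℤ s Cℤ suc r          ≡⟨ ℤ.+-identityˡ _ ⟩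
    s Cℤ suc r                ∎

  reflection-step : ∀ r D →
    (∀ a j → suc (a + j) ≡ s + r → a Cℤ r ≡ (-1ℤ ^ℤ r) *ℤ j Cℤ r [mod M ]) →
    (s + r) Cℤ suc r ≡ D [mod M ] →
    ∀ j a → a + j ≡ s + r → a Cℤ suc r ≡ (-1ℤ ^ℤ suc r) *ℤ j Cℤ suc r +ℤ D [mod M ]
  reflection-step r D reflection-at-r diagonal zero a a+0≡s+r = begin
    a Cℤ suc r                         ≡⟨ cong (_Cℤ suc r) (trans (sym (ℕ.+-identityʳ a)) a+0≡s+r) ⟩
    (s + r) Cℤ suc r                   ≈⟨ diagonal ⟩
    D                                  ≡⟨ sym (ℤ.+-identityˡ D) ⟩
    0ℤ +ℤ D                            ≡⟨ cong (_+ℤ D) (sym (ℤ.*-zeroʳ (-1ℤ ^ℤ suc r))) ⟩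
    (-1ℤ ^ℤ suc r) *ℤ 0 Cℤ suc r +ℤ D  ∎
  reflection-step r D reflection-at-r diagonal (suc j) a a+1+j≡s+r = begin
    a Cℤ suc r
      ≡⟨ add-sub (a Cℤ r) (a Cℤ suc r) ⟩
    (a Cℤ r +ℤ a Cℤ suc r) -ℤ a Cℤ r
      ≡⟨ cong (_-ℤ a Cℤ r) (sym (pascal a r)) ⟩
    suc a Cℤ suc r -ℤ a Cℤ r
      ≈⟨ +-cong-mod (reflection-step r D reflection-at-r diagonal j (suc a) 1+a+j≡s+r)
                    (neg-cong-mod (reflection-at-r a j 1+a+j≡s+r)) ⟩
    ((-1ℤ ^ℤ suc r) *ℤ j Cℤ suc r +ℤ D) -ℤ (-1ℤ ^ℤ r) *ℤ j Cℤ r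
      ≡⟨ regroup (-1ℤ ^ℤ r) (j Cℤ r) (j Cℤ suc r) D ⟩
    (-1ℤ ^ℤ suc r) *ℤ (j Cℤ r +ℤ j Cℤ suc r) +ℤ D
      ≡⟨ cong (λ x → (-1ℤ ^ℤ suc r) *ℤ x +ℤ D) (sym (pascal j r)) ⟩
    (-1ℤ ^ℤ suc r) *ℤ suc j Cℤ suc r +ℤ D ∎
    where
    1+a+j≡s+r : suc (a + j) ≡ s + r
    1+a+j≡s+r = trans (sym (ℕ.+-suc a j)) a+1+j≡s+r
    add-sub : ∀ x y → y ≡ (x +ℤ y) -ℤ x
    add-sub = ℤ-Solver.solve-∀
    regroup : ∀ σ x y D → ((-1ℤ *ℤ σ) *ℤ y +ℤ D) -ℤ σ *ℤ x ≡ (-1ℤ *ℤ σ) *ℤ (x +ℤ y) +ℤ D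
    regroup = ℤ-Solver.solve-∀

  reflection     : ∀ r → r < m → ∀ a j → suc (a + j) ≡ s + r →
                   a Cℤ r ≡ (-1ℤ ^ℤ r) *ℤ j Cℤ r [mod M ]
  reflection-suc : ∀ r → suc r ≤ m → ∀ a j → a + j ≡ s + r →
                   a Cℤ suc r ≡ (-1ℤ ^ℤ suc r) *ℤ j Cℤ suc r +ℤ s Cℤ suc r [mod M ]

  reflection zero    _   a j _          = ≡-mod-reflexive refl
  reflection (suc r) r<m a j a+j+1≡s+r = begin
    a Cℤ suc r
      ≈⟨ reflection-suc r (ℕ.<⇒≤ r<m) a j a+j≡s+r ⟩
    (-1ℤ ^ℤ suc r) *ℤ j Cℤ suc r +ℤ s Cℤ suc r
      ≈⟨ +-congˡ-mod ((-1ℤ ^ℤ suc r) *ℤ j Cℤ suc r) (vanish (suc r) z<s r<m) ⟩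
    (-1ℤ ^ℤ suc r) *ℤ j Cℤ suc r +ℤ 0ℤ
      ≡⟨ ℤ.+-identityʳ _ ⟩
    (-1ℤ ^ℤ suc r) *ℤ j Cℤ suc r ∎
    where
    a+j≡s+r : a + j ≡ s + r
    a+j≡s+r = ℕ.suc-injective (trans a+j+1≡s+r (ℕ.+-suc s r))

  reflection-suc r r<m a j a+j≡s+r =
    reflection-step r (s Cℤ suc r) (reflection r r<m) ([s+r]C[1+r]≡sC[1+r] r r<m) j a a+j≡s+r

  reflection-top : .{{_ : NonZero m}} → ∀ a j → a + j ≡ s + pred m →
                   a Cℤ m ≡ (-1ℤ ^ℤ m) *ℤ j Cℤ m +ℤ s Cℤ m [mod M ]
  reflection-top a j a+j≡s+r =
    subst (λ t → a Cℤ t ≡ (-1ℤ ^ℤ t) *ℤ j Cℤ t +ℤ s Cℤ t [mod M ]) (ℕ.suc-pred m)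
      (reflection-suc (pred m) (ℕ.≤-reflexive (ℕ.suc-pred m)) a j a+j≡s+r)

-- Binomial coefficients C(2^μ k u, i) modulo 2k

NoOddPrimeFactorBelow : ℕ → ℕ → Set
NoOddPrimeFactorBelow B c = ∀ p → Prime p → ¬ 2 ∣ p → p < B → ¬ p ∣ c

prime-divisor : ∀ d .{{_ : NonTrivial d}} → ∃ λ p → Prime p × p ∣ d
prime-divisor d@(suc (suc _)) with factorise d
... | record { factors = p ∷ ps ; isFactorisation = d≡Π ; factorsPrime = prime[p] ∷ _ } =
  p , prime[p] , subst (p ∣_) (sym d≡Π) (m∣m*n (product ps))

odd-prime∤2 : ∀ {p} → Prime p → ¬ 2 ∣ p → ¬ p ∣ 2
odd-prime∤2 {p} prime[p] 2∤p p∣2 =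
  2∤p (∣-reflexive (ℕ.≤-antisym (nonTrivial⇒n>1 p {{prime⇒nonTrivial prime[p]}}) (∣⇒≤ p∣2)))

odd-prime∣2^e*c⇒∣c : ∀ {p} e {c} → Prime p → ¬ 2 ∣ p → p ∣ 2 ^ e * c → p ∣ c
odd-prime∣2^e*c⇒∣c {p} zero    {c} _        _   p∣c    = subst (p ∣_) (ℕ.+-identityʳ c) p∣c
odd-prime∣2^e*c⇒∣c {p} (suc e) {c} prime[p] 2∤p p∣2^e*c
  with euclidsLemma 2 (2 ^ e * c) prime[p] (subst (p ∣_) (ℕ.*-assoc 2 (2 ^ e) c) p∣2^e*c)
... | inj₁ p∣2 = contradiction p∣2 (odd-prime∤2 prime[p] 2∤p)
... | inj₂ p∣c = odd-prime∣2^e*c⇒∣c e prime[p] 2∤p p∣c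

odd-coprime : ∀ {B c i} e → NoOddPrimeFactorBelow B c → ¬ 2 ∣ i → i < B → Coprime (2 ^ e * c) i
odd-coprime {B} {c} {i} e small∤c 2∤i i<B = common-divisor≡1
  where
  instance
    i≢0 : NonZero i
    i≢0 = ≢-nonZero λ { refl → 2∤i (2 ∣0) }
  common-divisor≡1 : ∀ {d} → d ∣ 2 ^ e * c × d ∣ i → d ≡ 1
  common-divisor≡1 {zero}            (_ , 0∣i) = contradiction (subst (2 ∣_) (sym (0∣⇒≡0 0∣i)) (2 ∣0)) 2∤i
  common-divisor≡1 {suc zero}        _         = refl
  common-divisor≡1 {d@(suc (suc _))} (d∣2^e*c , d∣i) with prime-divisor d
  ... | p , prime[p] , p∣d =
    contradiction (odd-prime∣2^e*c⇒∣c e prime[p] 2∤p (∣-trans p∣d d∣2^e*c))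
                  (small∤c p prime[p] 2∤p (ℕ.≤-<-trans (∣⇒≤ p∣i) i<B))
    where
    p∣i : p ∣ i
    p∣i = ∣-trans p∣d d∣i
    2∤p : ¬ 2 ∣ p
    2∤p 2∣p = 2∤i (∣-trans 2∣p p∣i)

2^μc∣iX⇒2c∣X : ∀ μ {c i X} → NoOddPrimeFactorBelow (2 ^ μ) c → 0 < i → i < 2 ^ μ →
               2 ^ μ * c ∣ i * X → 2 * c ∣ X
2^μc∣iX⇒2c∣X zero    _       0<i i<1 _ = contradiction (ℕ.≤-pred i<1) (ℕ.<⇒≱ 0<i)
2^μc∣iX⇒2c∣X (suc μ) {c} {i} {X} small∤c 0<i i<2^μ 2^μc∣iX with 2 ∣? i
... | no 2∤i = ∣-trans (*-monoˡ-∣ c (m∣m*n {2} (2 ^ μ)))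
                       (coprime-divisor (odd-coprime (suc μ) small∤c 2∤i i<2^μ) 2^μc∣iX)
2^μc∣iX⇒2c∣X (suc μ) _ () _ _ | yes (divides zero refl)
... | yes (divides i'@(suc _) refl) =
  2^μc∣iX⇒2c∣X μ small∤c′ z<s i'<2^μ
    (*-cancelˡ-∣ 2 (subst₂ _∣_ (ℕ.*-assoc 2 (2 ^ μ) c) (regroup i' X) 2^μc∣iX))
  where
  small∤c′ : NoOddPrimeFactorBelow (2 ^ μ) c
  small∤c′ p prime[p] 2∤p p<2^μ = small∤c p prime[p] 2∤p (ℕ.<-≤-trans p<2^μ (ℕ.m≤m+n (2 ^ μ) _))
  i'<2^μ : i' < 2 ^ μ
  i'<2^μ = ℕ.*-cancelʳ-< 2 i' (2 ^ μ) (subst (i' * 2 <_) (ℕ.*-comm 2 (2 ^ μ)) i<2^μ)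
  regroup : ∀ i' X → i' * 2 * X ≡ 2 * (i' * X)
  regroup = ℕ-Solver.solve-∀

absorption : ∀ n k → suc k * (suc n C suc k) ≡ suc n * (n C k)
absorption zero    zero    = refl
absorption zero    (suc k) = ℕ.*-zeroʳ (suc (suc k))
absorption (suc n) zero    =
  trans (ℕ.*-identityˡ _) (trans (nC1≡n (suc (suc n))) (sym (ℕ.*-identityʳ _)))
absorption (suc n) (suc k) = begin
  suc (suc k) * (suc (suc n) C suc (suc k))
    ≡⟨ cong (suc (suc k) *_) (sym (nCk+nC[k+1]≡[n+1]C[k+1] (suc n) (suc k))) ⟩
  suc (suc k) * (x + y)
    ≡⟨ regroup k x y ⟩
  x + (suc k * x + suc (suc k) * y)
    ≡⟨ cong (_+_ x) (cong₂ _+_ (absorption n k) (absorption n (suc k))) ⟩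
  x + (suc n * (n C k) + suc n * (n C suc k))
    ≡⟨ cong (_+_ x) (sym (ℕ.*-distribˡ-+ (suc n) (n C k) (n C suc k))) ⟩
  x + suc n * (n C k + n C suc k)
    ≡⟨ cong (λ z → x + suc n * z) (nCk+nC[k+1]≡[n+1]C[k+1] n k) ⟩
  suc (suc n) * x ∎
  where
  open ≡-Reasoning
  x = suc n C suc k
  y = suc n C suc (suc k)
  regroup : ∀ k x y → suc (suc k) * (x + y) ≡ x + (suc k * x + suc (suc k) * y)
  regroup = ℕ-Solver.solve-∀

2c∣sCi : ∀ μ {c s i} .{{_ : NonZero s}} → NoOddPrimeFactorBelow (2 ^ μ) c → 2 ^ μ * c ∣ s →
         0 < i → i < 2 ^ μ → 2 * c ∣ s C i
2c∣sCi μ {c} {suc s} {suc i} small∤c 2^μc∣s _ i<2^μ =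
  2^μc∣iX⇒2c∣X μ small∤c z<s i<2^μ
    (subst (2 ^ μ * c ∣_) (sym (absorption s i)) (∣m⇒∣m*n (s C i) 2^μc∣s))

noOddPrimeFactorBelow-1 : ∀ B → NoOddPrimeFactorBelow B 1
noOddPrimeFactorBelow-1 B p prime[p] _ _ p∣1 = ¬prime[1] (subst Prime (∣1⇒≡1 p∣1) prime[p])

2∤nCr : ∀ μ {n r} → 2 ^ μ ∣ suc n → r < 2 ^ μ → ¬ 2 ∣ n C r
2∤nCr μ {n} {zero}  _        _       2∣1 = contradiction (∣⇒≤ 2∣1) (ℕ.<⇒≱ (ℕ.n<1+n 1))
2∤nCr μ {n} {suc r} 2^μ∣1+n r+1<2^μ 2∣nC[r+1] =
  2∤nCr μ 2^μ∣1+n (ℕ.<-trans (ℕ.n<1+n r) r+1<2^μ)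
    (∣m+n∣m⇒∣n (subst (2 ∣_) (ℕ.+-comm (n C r) (n C suc r)) 2∣[1+n]C[r+1]) 2∣nC[r+1])
  where
  2^μ*1∣1+n : 2 ^ μ * 1 ∣ suc n
  2^μ*1∣1+n = subst (_∣ suc n) (sym (ℕ.*-identityʳ (2 ^ μ))) 2^μ∣1+n
  2∣[1+n]C[r+1] : 2 ∣ n C r + n C suc r
  2∣[1+n]C[r+1] = subst (2 ∣_) (sym (nCk+nC[k+1]≡[n+1]C[k+1] n r))
    (2c∣sCi μ (noOddPrimeFactorBelow-1 (2 ^ μ)) 2^μ*1∣1+n z<s r+1<2^μ)

sCm≡x*[s-1]C[m-1] : ∀ {s m x} .{{_ : NonZero s}} .{{_ : NonZero m}} →
                    s ≡ m * x → s C m ≡ x * (pred s C pred m)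
sCm≡x*[s-1]C[m-1] {suc s} {suc m} {x} s≡m*x = ℕ.*-cancelˡ-≡ _ _ (suc m) (begin
  suc m * (suc s C suc m)  ≡⟨ absorption s m ⟩
  suc s * (s C m)          ≡⟨ cong (_* (s C m)) s≡m*x ⟩
  suc m * x * (s C m)      ≡⟨ ℕ.*-assoc (suc m) x (s C m) ⟩
  suc m * (x * (s C m))    ∎)
  where open ≡-Reasoning

odd⇒≡1+q*2 : ∀ {w} → ¬ 2 ∣ w → ∃ λ q → w ≡ suc (q * 2)
odd⇒≡1+q*2 {zero}          2∤0 = contradiction (2 ∣0) 2∤0
odd⇒≡1+q*2 {suc zero}      _   = 0 , refl
odd⇒≡1+q*2 {suc (suc w)}   2∤2+w with odd⇒≡1+q*2 {w} (λ 2∣w → 2∤2+w (∣m∣n⇒∣m+n (∣-refl {2}) 2∣w))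
... | q , w≡1+q*2 = suc q , cong (λ x → suc (suc x)) w≡1+q*2

-1^[2*n]≡1 : ∀ n → -1ℤ ^ℤ (2 * n) ≡ 1ℤ
-1^[2*n]≡1 n = trans (sym (ℤ.^-*-assoc -1ℤ 2 n)) (ℤ.^-zeroˡ n)

2∤1+2n : ∀ n → ¬ 2 ∣ suc (2 * n)
2∤1+2n n (divides q 1+2n≡q*2) = ℕ.even≢odd q n (trans (ℕ.*-comm 2 q) (sym 1+2n≡q*2))

sC2^μ≡c[mod2c] : ∀ μ {c u s} .{{_ : NonZero s}} → ¬ 2 ∣ u → s ≡ 2 ^ μ * (c * u) →
                 s Cℤ (2 ^ μ) ≡ + c [mod + (2 * c) ]
sC2^μ≡c[mod2c] μ {c} {u} {s} 2∤u s≡m*cu = offset⇒+≡+[mod] q (begin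
  s C m                        ≡⟨ sCm≡x*[s-1]C[m-1] {s} {m} s≡m*cu ⟩
  c * u * (pred s C pred m)    ≡⟨ ℕ.*-assoc c u _ ⟩
  c * (u * (pred s C pred m))  ≡⟨ cong (c *_) w≡1+q*2 ⟩
  c * suc (q * 2)              ≡⟨ regroup c q ⟩
  c + q * (2 * c)              ∎)
  where
  open ≡-Reasoning
  m = 2 ^ μ
  instance
    m≢0 : NonZero m
    m≢0 = ℕ.m^n≢0 2 μ
  m∣1+[s-1] : m ∣ suc (pred s)
  m∣1+[s-1] = subst (m ∣_) (sym (trans (ℕ.suc-pred s) s≡m*cu)) (m∣m*n (c * u))
  2∤w : ¬ 2 ∣ u * (pred s C pred m)
  2∤w 2∣w = [ 2∤u , 2∤nCr μ m∣1+[s-1] (ℕ.≤-reflexive (ℕ.suc-pred m)) ]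
              (euclidsLemma u (pred s C pred m) prime[2] 2∣w)
  q = proj₁ (odd⇒≡1+q*2 2∤w)
  w≡1+q*2 = proj₂ (odd⇒≡1+q*2 2∤w)
  regroup : ∀ c q → c * suc (q * 2) ≡ c + q * (2 * c)
  regroup = ℕ-Solver.solve-∀

aC2^μ≡jC2^μ+k[mod2k] : ∀ μ {k u s} .{{_ : NonZero s}} →
  NoOddPrimeFactorBelow (2 ^ suc μ) k → ¬ 2 ∣ u → s ≡ 2 ^ suc μ * (k * u) →
  ∀ a j → a + j ≡ s + pred (2 ^ suc μ) → a Cℤ (2 ^ suc μ) ≡ j Cℤ (2 ^ suc μ) +ℤ + k [mod + (2 * k) ]
aC2^μ≡jC2^μ+k[mod2k] μ {k} {u} {s} small∤k 2∤u s≡m*ku a j a+j≡s+r = begin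
  a Cℤ m
    ≈⟨ reflection-top a j a+j≡s+r ⟩
  (-1ℤ ^ℤ m) *ℤ j Cℤ m +ℤ s Cℤ m
    ≡⟨ cong (λ σ → σ *ℤ j Cℤ m +ℤ s Cℤ m) (-1^[2*n]≡1 (2 ^ μ)) ⟩
  1ℤ *ℤ j Cℤ m +ℤ s Cℤ m
    ≡⟨ cong (_+ℤ s Cℤ m) (ℤ.*-identityˡ (j Cℤ m)) ⟩
  j Cℤ m +ℤ s Cℤ m
    ≈⟨ +-congˡ-mod (j Cℤ m) (sC2^μ≡c[mod2c] (suc μ) 2∤u s≡m*ku) ⟩
  j Cℤ m +ℤ + k ∎
  where
  m = 2 ^ suc μ
  instance
    m≢0 : NonZero m
    m≢0 = ℕ.m^n≢0 2 (suc μ)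
  open ≡-mod-Reasoning (+ (2 * k))

  2^μk∣s : m * k ∣ s
  2^μk∣s = divides u (trans s≡m*ku (regroup m k u))
    where
    regroup : ∀ m k u → m * (k * u) ≡ u * (m * k)
    regroup = ℕ-Solver.solve-∀

  vanish : ∀ i → 0 < i → i < m → s Cℤ i ≡ 0ℤ [mod + (2 * k) ]
  vanish i 0<i i<m with 2c∣sCi (suc μ) small∤k 2^μk∣s 0<i i<m
  ... | divides q sCi≡q*2k = offset⇒+≡+[mod] q sCi≡q*2k

  open BinomialCongruences vanish

z^k+1∣f[2^μ,2^μku+2^μ-1] : ∀ μ {k u} .{{_ : NonZero k}} .{{_ : NonZero u}} →
  NoOddPrimeFactorBelow (2 ^ suc μ) k → ¬ 2 ∣ u →
  zpow+1 k ∣ₚ f (2 ^ suc μ) (2 ^ suc μ * (k * u) + pred (2 ^ suc μ))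
z^k+1∣f[2^μ,2^μku+2^μ-1] μ {k} {u} small∤k 2∤u = z^K+1∣f k m n a 1+n≡a+a λ j j<a →
  aC2^μ≡jC2^μ+k[mod2k] μ small∤k 2∤u refl (n ∸ j) j (ℕ.m∸n+n≡m (<half⇒≤ 1+n≡a+a j<a))
  where
  m = 2 ^ suc μ
  s = m * (k * u)
  n = s + pred m
  a = 2 ^ μ * suc (k * u)
  instance
    m≢0 : NonZero m
    m≢0 = ℕ.m^n≢0 2 (suc μ)
    ku≢0 : NonZero (k * u)
    ku≢0 = ℕ.m*n≢0 k u
    s≢0 : NonZero s
    s≢0 = ℕ.m*n≢0 m (k * u)
  1+n≡a+a : suc n ≡ a + a
  1+n≡a+a = trans (sym (ℕ.+-suc s (pred m)))
                  (trans (cong (_+_ s) (ℕ.suc-pred m)) (regroup (2 ^ μ) (k * u)))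
    where
    regroup : ∀ P x → 2 * P * x + 2 * P ≡ P * suc x + P * suc x
    regroup = ℕ-Solver.solve-∀

corollary3p4 : (μ k : ℕ) → 1 ≤ μ → 1 ≤ k →
    (∀ p → Prime p → ¬ (2 ∣ p) → p < 2 ^ μ → ¬ (p ∣ k)) →
    ∀ N → ∃ λ n → N ≤ n × (zpow+1 k ∣ₚ f (2 ^ μ) n)
corollary3p4 (suc μ) k _ 1≤k small∤k N =
  m * (k * u) + pred m , N≤n , z^k+1∣f[2^μ,2^μku+2^μ-1] μ small∤k (2∤1+2n N)
  where
  m = 2 ^ suc μ
  u = suc (2 * N)
  instance
    k≢0 : NonZero k
    k≢0 = >-nonZero 1≤k
    m≢0 : NonZero m
    m≢0 = ℕ.m^n≢0 2 (suc μ)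
  N≤n : N ≤ m * (k * u) + pred m
  N≤n = begin
    N                     ≤⟨ ℕ.m≤n*m N 2 ⟩
    2 * N                 ≤⟨ ℕ.n≤1+n _ ⟩
    u                     ≤⟨ ℕ.m≤n*m u k ⟩
    k * u                 ≤⟨ ℕ.m≤n*m (k * u) m ⟩
    m * (k * u)           ≤⟨ ℕ.m≤m+n _ (pred m) ⟩
    m * (k * u) + pred m  ∎
    where open ℕ.≤-Reasoning
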